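{- For any integer $t\geq 3$ and any positive integer $k$, there exists a finite simple $K_{1,t}$-free graph $G$ such that $\chi(G)=k$ and $\varphi(G)=(t-1)(k-1)+1$.
   Context: $G$ is $K_{1,t}$-free if it contains no induced subgraph isomorphic to the star $K_{1,t}$. $\chi(G)$ is the chromatic number. A $b$-coloring of $G$ with $b$ colors is a proper coloring of $V(G)$ using exactly $b$ colors such that for every color $i$ there is a vertex of color $i$ having neighbors of all the other $b-1$ colors. The $b$-chromatic number $\varphi(G)$ is the largest $b$ for which such a coloring exists. -}

module Defs where

open import Data.Nat using (ℕ; _<_; _>_)
open import Data.Fin using (Fin)
open import Data.Bool using (Bool; true; false)
open import Data.Product using (Σ; ∃; _×_; _,_)
open import Relation.Binary.PropositionalEquality using (_≡_; _≢_)
open import Relation.Nullary using (¬_)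
open import Function.Definitions using (Injective; Surjective)

record Graph : Set where
  field
    n     : ℕ
    adj   : Fin n → Fin n → Bool
    sym   : ∀ u v → adj u v ≡ adj v u
    irrefl : ∀ v → adj v v ≡ false

open Graph public

Adj : (G : Graph) → Fin (n G) → Fin (n G) → Set
Adj G u v = adj G u v ≡ true

-- G contains an induced K_{1,t}: a centre v and t distinct leaves, each adjacent
-- to v, pairwise non-adjacent (leaves are automatically distinct from v by irreflexivity).
HasInducedStar : ℕ → Graph → Set
HasInducedStar t G =
  Σ (Fin (n G)) λ v → Σ (Fin t → Fin (n G)) λ leaf →
    Injective _≡_ _≡_ leaf
    × (∀ i → Adj G v (leaf i))
    × (∀ i j → adj G (leaf i) (leaf j) ≡ false)

K1t-free : ℕ → Graph → Set
K1t-free t G = ¬ HasInducedStar t G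

Proper : (G : Graph) {b : ℕ} → (Fin (n G) → Fin b) → Set
Proper G c = ∀ u v → Adj G u v → c u ≢ c v

Colorable : Graph → ℕ → Set
Colorable G k = Σ (Fin (n G) → Fin k) λ c → Proper G c

ChromaticNumber : Graph → ℕ → Set
ChromaticNumber G k = Colorable G k × (∀ j → j < k → ¬ Colorable G j)

IsBColoring : (G : Graph) (b : ℕ) → (Fin (n G) → Fin b) → Set
IsBColoring G b c =
  Proper G c
  × Surjective _≡_ _≡_ c
  × (∀ (i : Fin b) → Σ (Fin (n G)) λ x → c x ≡ i ×
       (∀ (j : Fin b) → j ≢ i → Σ (Fin (n G)) λ y → Adj G x y × c y ≡ j))

HasBColoring : Graph → ℕ → Set
HasBColoring G b = Σ (Fin (n G) → Fin b) λ c → IsBColoring G b c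

BChromaticNumber : Graph → ℕ → Set
BChromaticNumber G m = HasBColoring G m × (∀ b → b > m → ¬ HasBColoring G b)

{-# OPTIONS --safe #-}
module Submission where

-- Let W be the windmill graph of t − 1 copies of K_k glued at a common center, and G the
-- disjoint union of |W| = (t − 1)(k − 1) + 1 copies of W. Every neighborhood in G is covered
-- by t − 1 cliques (the blades, at a center; a single clique elsewhere), so G is K_{1,t}-free.
-- A blade is a k-clique, and coloring each non-center vertex by its position in its blade
-- (the center getting the remaining color) shows χ(G) = k. Every closed neighborhood has at
-- most |W| vertices, so φ(G) ≤ |W|; conversely, color the i-th copy of W bijectively with
-- |W| colors so that its center gets color i: that center is then a b-vertex for color i.

open import Defs hiding (sym)
open import Data.Nat using (ℕ; zero; suc; _≤_; _<_; _+_; _*_; _∸_; s≤s; z≤n)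
open import Data.Nat.Properties using (≤-refl)
open import Data.Fin using (Fin; zero; suc; _≟_)
open import Data.Fin.Properties
  using (pigeonhole; <⇒≢; <⇒notInjective; suc-injective; +↔⊎; *↔×; 1↔⊤)
open import Data.Fin.Permutation using (Permutation; transpose; _⟨$⟩ʳ_; _⟨$⟩ˡ_; inverseʳ)
open import Data.Product using (Σ; _×_; _,_; proj₁; proj₂)
open import Data.Product.Function.NonDependent.Propositional using (_×-↔_)
open import Data.Sum using (_⊎_; inj₁; inj₂)
open import Data.Sum.Function.Propositional using (_⊎-↔_)
open import Data.Unit using (⊤; tt)
open import Data.Empty using (⊥)
open import Function using (_∘_; case_of_)
open import Function.Bundles using (_↔_; Inverse; Injection; mk⇔; mk↔ₛ′)
open import Function.Properties.Inverse using (↔-refl; ↔-sym; ↔-trans; ↔⇒↣)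
open import Level using (0ℓ)
open import Relation.Binary using (Rel; Decidable; Symmetric)
open import Relation.Binary.PropositionalEquality
  using (_≡_; _≢_; refl; sym; trans; cong; cong₂; subst; subst₂; ≢-sym; module ≡-Reasoning)
open import Relation.Nullary using (¬_; yes; no; does; contradiction)
open import Relation.Nullary.Decidable using (_×-dec_; ¬?; dec-true; dec-false; does-⇔)

module _ {V : Set} (_~_ : Rel V 0ℓ) where

  Clique : ∀ {k} → (Fin k → V) → Set
  Clique q = ∀ i j → i ≢ j → q i ~ q j

  ProperColoring : ∀ {k} → (V → Fin k) → Set
  ProperColoring c = ∀ x y → x ~ y → c x ≢ c y

  BVertex : ∀ {b} → (V → Fin b) → Fin b → V → Set
  BVertex c i x = c x ≡ i × (∀ j → j ≢ i → Σ V λ y → x ~ y × c y ≡ j)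

  MaxDegree< : ℕ → Set
  MaxDegree< b = ∀ x → Σ (∀ y → y ≡ x ⊎ x ~ y → Fin b) λ f →
    ∀ {y y'} p p' → f y p ≡ f y' p' → y ≡ y'

  NeighborhoodCliqueCover : ℕ → Set
  NeighborhoodCliqueCover s = ∀ x → Σ (∀ y → x ~ y → Fin s) λ label →
    ∀ {y y'} r r' → label y r ≡ label y' r' → y ≢ y' → y ~ y'

clique⇒¬colorable : ∀ (G : Graph) {k j} (q : Fin k → Fin (n G)) → Clique (Adj G) q →
  j < k → ¬ Colorable G j
clique⇒¬colorable G q clique j<k (c , proper) with pigeonhole j<k (c ∘ q)
... | i , i' , i<i' , same = proper (q i) (q i') (clique i i' (<⇒≢ i<i')) same

chromaticNumber : ∀ (G : Graph) {k} → Colorable G k → Σ (Fin k → Fin (n G)) (Clique (Adj G)) →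
  ChromaticNumber G k
chromaticNumber G colorable (q , clique) = colorable , λ _ j<k → clique⇒¬colorable G q clique j<k

-- The b-vertex of color 0 and its neighbors carry all b' colors, so they are
-- b' distinct vertices of a single closed neighborhood.
maxDegree<⇒¬HasBColoring : ∀ (G : Graph) {b b'} → MaxDegree< (Adj G) b → b < b' → ¬ HasBColoring G b'
maxDegree<⇒¬HasBColoring G {b} {b'@(suc _)} Δ<b b<b' (c , _ , _ , bVertex) =
  <⇒notInjective {f = λ j → index (vertex j) (inClosedNeighborhood j)} b<b' λ {i} {j} sameIndex →
    begin
      i              ≡⟨ colored i ⟨
      c (vertex i)   ≡⟨ cong c (index-injective (inClosedNeighborhood i) (inClosedNeighborhood j) sameIndex) ⟩
      c (vertex j)   ≡⟨ colored j ⟩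
      j              ∎
  where
  open ≡-Reasoning
  x : Fin (n G)
  x = proj₁ (bVertex zero)
  representative : ∀ j → Σ (Fin (n G)) λ y → (y ≡ x ⊎ Adj G x y) × c y ≡ j
  representative zero = x , inj₁ refl , proj₁ (proj₂ (bVertex zero))
  representative (suc j) with proj₂ (proj₂ (bVertex zero)) (suc j) (λ ())
  ... | y , adjacent , color-j = y , inj₂ adjacent , color-j
  vertex : Fin b' → Fin (n G)
  vertex j = proj₁ (representative j)
  inClosedNeighborhood : ∀ j → vertex j ≡ x ⊎ Adj G x (vertex j)
  inClosedNeighborhood j = proj₁ (proj₂ (representative j))
  colored : ∀ j → c (vertex j) ≡ j
  colored j = proj₂ (proj₂ (representative j))
  index : ∀ y → y ≡ x ⊎ Adj G x y → Fin b
  index = proj₁ (Δ<b x)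
  index-injective : ∀ {y y'} p p' → index y p ≡ index y' p' → y ≡ y'
  index-injective = proj₂ (Δ<b x)

bChromaticNumber : ∀ (G : Graph) {b} → HasBColoring G b → MaxDegree< (Adj G) b → BChromaticNumber G b
bChromaticNumber G bColoring Δ<b = bColoring , λ _ b<b' → maxDegree<⇒¬HasBColoring G Δ<b b<b'

neighborhoodCliqueCover⇒K1t-free : ∀ (G : Graph) {s t} → NeighborhoodCliqueCover (Adj G) s → s < t →
  K1t-free t G
neighborhoodCliqueCover⇒K1t-free G cover s<t (v , leaf , leaf-injective , adjacent , independent)
  with pigeonhole s<t (λ i → proj₁ (cover v) (leaf i) (adjacent i))
... | i , j , i<j , sameClique =
  contradiction (trans (sym (independent i j)) adjacentLeaves) λ ()
  where
  adjacentLeaves : Adj G (leaf i) (leaf j)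
  adjacentLeaves = proj₂ (cover v) (adjacent i) (adjacent j) sameClique (<⇒≢ i<j ∘ leaf-injective)

module RelationGraph {V : Set} {N : ℕ} (enumeration : Fin N ↔ V) {_~_ : Rel V 0ℓ}
  (_~?_ : Decidable _~_) (~-sym : Symmetric _~_) (~-irrefl : ∀ x → ¬ x ~ x) where

  open Inverse enumeration public using (to; from)
  open Inverse enumeration using (strictlyInverseˡ)

  graph : Graph
  graph = record
    { n = N
    ; adj = λ u w → does (to u ~? to w)
    ; sym = λ u w → does-⇔ (mk⇔ ~-sym ~-sym) (to u ~? to w) (to w ~? to u)
    ; irrefl = λ u → dec-false (to u ~? to u) (~-irrefl (to u))
    }

  to-injective : ∀ {u w} → to u ≡ to w → u ≡ w
  to-injective = Injection.injective (↔⇒↣ enumeration)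

  Adj⇒~ : ∀ {u w} → Adj graph u w → to u ~ to w
  Adj⇒~ {u} {w} adjacent with to u ~? to w
  ... | yes r = r
  ... | no _ = case adjacent of λ ()

  ~⇒Adj : ∀ {u w} → to u ~ to w → Adj graph u w
  ~⇒Adj {u} {w} = dec-true (to u ~? to w)

  ~⇒Adj-from : ∀ {x y} → x ~ y → Adj graph (from x) (from y)
  ~⇒Adj-from {x} {y} = ~⇒Adj ∘ subst₂ _~_ (sym (strictlyInverseˡ x)) (sym (strictlyInverseˡ y))

  clique : ∀ {k} {q : Fin k → V} → Clique _~_ q → Clique (Adj graph) (from ∘ q)
  clique isClique i j i≢j = ~⇒Adj-from (isClique i j i≢j)

  colorable : ∀ {k} (c : V → Fin k) → ProperColoring _~_ c → Colorable graph k
  colorable c proper = c ∘ to , λ u w → proper (to u) (to w) ∘ Adj⇒~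

  neighborhoodCliqueCover : ∀ {s} → NeighborhoodCliqueCover _~_ s →
    NeighborhoodCliqueCover (Adj graph) s
  neighborhoodCliqueCover cover u with cover (to u)
  ... | label , covered =
    (λ w → label (to w) ∘ Adj⇒~) ,
    λ a a' sameLabel distinct →
      ~⇒Adj (covered (Adj⇒~ a) (Adj⇒~ a') sameLabel (distinct ∘ to-injective))

  closedNeighbor : ∀ {u w} → w ≡ u ⊎ Adj graph u w → to w ≡ to u ⊎ to u ~ to w
  closedNeighbor (inj₁ w≡u) = inj₁ (cong to w≡u)
  closedNeighbor (inj₂ adjacent) = inj₂ (Adj⇒~ adjacent)

  maxDegree< : ∀ {b} → MaxDegree< _~_ b → MaxDegree< (Adj graph) b
  maxDegree< Δ<b u with Δ<b (to u)
  ... | index , index-injective =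
    (λ w → index (to w) ∘ closedNeighbor) ,
    λ p p' sameIndex → to-injective (index-injective (closedNeighbor p) (closedNeighbor p') sameIndex)

  hasBColoring : ∀ {b} (c : V → Fin b) → ProperColoring _~_ c → (∀ i → Σ V (BVertex _~_ c i)) →
    HasBColoring graph b
  hasBColoring c proper bVertex =
    c ∘ to ,
    (λ u w → proper (to u) (to w) ∘ Adj⇒~) ,
    (λ i → from (proj₁ (bVertex i)) , λ { refl → proj₁ (transported (bVertex i)) }) ,
    λ i → from (proj₁ (bVertex i)) , transported (bVertex i)
    where
    color-from : ∀ x {i} → c x ≡ i → c (to (from x)) ≡ i
    color-from x = trans (cong c (strictlyInverseˡ x))
    transported : ∀ {i} (bv : Σ V (BVertex _~_ c i)) →
      BVertex (Adj graph) (c ∘ to) i (from (proj₁ bv))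
    transported (x , color-x , neighbor) =
      color-from x color-x ,
      λ j j≢i → let y , x~y , color-y = neighbor j j≢i in
        from y , ~⇒Adj-from x~y , color-from y color-y

transpose-j≡i : ∀ {n} (i j : Fin n) → transpose i j ⟨$⟩ʳ j ≡ i
transpose-j≡i i j with j ≟ i
... | yes j≡i = j≡i
... | no _ rewrite dec-true (j ≟ j) refl = refl

module DisjointCopies {P : Set} {b : ℕ} (enumeration : Fin b ↔ P) {_⌢_ : Rel P 0ℓ}
  (_⌢?_ : Decidable _⌢_) (⌢-sym : Symmetric _⌢_) (⌢-irrefl : ∀ x → ¬ x ⌢ x) where

  open Inverse enumeration using (strictlyInverseʳ) renaming (to to toP; from to fromP)

  fromP-injective : ∀ {x y} → fromP x ≡ fromP y → x ≡ y
  fromP-injective = Injection.injective (↔⇒↣ (↔-sym enumeration))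

  _~_ : Rel (Fin b × P) 0ℓ
  (i , x) ~ (j , y) = i ≡ j × x ⌢ y

  _~?_ : Decidable _~_
  (i , x) ~? (j , y) = (i ≟ j) ×-dec (x ⌢? y)

  ~-sym : Symmetric _~_
  ~-sym (i≡j , x⌢y) = sym i≡j , ⌢-sym x⌢y

  ~-irrefl : ∀ v → ¬ v ~ v
  ~-irrefl (_ , x) (_ , x⌢x) = ⌢-irrefl x x⌢x

  open RelationGraph (↔-trans *↔× (↔-refl ×-↔ enumeration)) _~?_ ~-sym ~-irrefl public

  sameCopy : ∀ {v w} → w ≡ v ⊎ v ~ w → proj₁ w ≡ proj₁ v
  sameCopy (inj₁ refl) = refl
  sameCopy (inj₂ (i≡j , _)) = sym i≡j

  copies-maxDegree< : MaxDegree< (Adj graph) b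
  copies-maxDegree< = maxDegree< λ _ →
    (λ w _ → fromP (proj₂ w)) ,
    λ p p' same → cong₂ _,_ (trans (sameCopy p) (sym (sameCopy p'))) (fromP-injective same)

  copies-neighborhoodCliqueCover : ∀ {s} → NeighborhoodCliqueCover _⌢_ s →
    NeighborhoodCliqueCover (Adj graph) s
  copies-neighborhoodCliqueCover cover = neighborhoodCliqueCover λ (_ , x) →
    (λ (_ , y) (_ , x⌢y) → proj₁ (cover x) y x⌢y) ,
    λ (i≡j , x⌢y) (i≡j' , x⌢y') sameLabel distinct →
      let j≡j' = trans (sym i≡j) i≡j' in
      j≡j' , proj₂ (cover x) x⌢y x⌢y' sameLabel (distinct ∘ cong₂ _,_ j≡j')

  copies-clique : ∀ {k} → Fin b → Σ (Fin k → P) (Clique _⌢_) →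
    Σ (Fin k → Fin (n graph)) (Clique (Adj graph))
  copies-clique i (q , isClique) =
    from ∘ (i ,_) ∘ q , clique λ j j' j≢j' → refl , isClique j j' j≢j'

  copies-colorable : ∀ {k} (c : P → Fin k) → ProperColoring _⌢_ c → Colorable graph k
  copies-colorable c proper = colorable (c ∘ proj₂) λ (_ , x) (_ , y) (_ , x⌢y) → proper x y x⌢y

  module _ (apex : P) (apex-dominating : ∀ x → x ≢ apex → apex ⌢ x) where

    swapWithApex : Fin b → Permutation b b
    swapWithApex i = transpose i (fromP apex)

    color : Fin b × P → Fin b
    color (i , x) = swapWithApex i ⟨$⟩ʳ fromP x

    color-proper : ProperColoring _~_ color
    color-proper (i , x) (_ , y) (refl , x⌢y) same = ⌢-irrefl y (subst (_⌢ y) x≡y x⌢y)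
      where
      x≡y : x ≡ y
      x≡y = fromP-injective (Injection.injective (↔⇒↣ (swapWithApex i)) same)

    apexNeighbor : ∀ i j → j ≢ i → Σ (Fin b × P) λ w → (i , apex) ~ w × color w ≡ j
    apexNeighbor i j j≢i = (i , toP (π ⟨$⟩ˡ j)) , (refl , apex-dominating _ notApex) , colored
      where
      open ≡-Reasoning
      π : Permutation b b
      π = swapWithApex i
      colored : π ⟨$⟩ʳ fromP (toP (π ⟨$⟩ˡ j)) ≡ j
      colored = trans (cong (π ⟨$⟩ʳ_) (strictlyInverseʳ _)) (inverseʳ π)
      notApex : toP (π ⟨$⟩ˡ j) ≢ apex
      notApex isApex = j≢i (begin
        j                                  ≡⟨ colored ⟨
        π ⟨$⟩ʳ fromP (toP (π ⟨$⟩ˡ j))       ≡⟨ cong (λ x → π ⟨$⟩ʳ fromP x) isApex ⟩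
        π ⟨$⟩ʳ fromP apex                   ≡⟨ transpose-j≡i i (fromP apex) ⟩
        i                                  ∎)

    copies-hasBColoring : HasBColoring graph b
    copies-hasBColoring = hasBColoring color color-proper λ i →
      (i , apex) , transpose-j≡i i (fromP apex) , apexNeighbor i

module Windmill (m k : ℕ) where

  data WindmillVertex : Set where
    blade : Fin m → Fin k → WindmillVertex
    center : WindmillVertex

  _⌢_ : Rel WindmillVertex 0ℓ
  blade β p ⌢ blade β' p' = β ≡ β' × p ≢ p'
  blade _ _ ⌢ center = ⊤
  center ⌢ blade _ _ = ⊤
  center ⌢ center = ⊥

  _⌢?_ : Decidable _⌢_
  blade β p ⌢? blade β' p' = (β ≟ β') ×-dec ¬? (p ≟ p')
  blade _ _ ⌢? center = yes tt
  center ⌢? blade _ _ = yes tt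
  center ⌢? center = no λ ()

  ⌢-sym : Symmetric _⌢_
  ⌢-sym {blade _ _} {blade _ _} (β≡β' , p≢p') = sym β≡β' , ≢-sym p≢p'
  ⌢-sym {blade _ _} {center} _ = tt
  ⌢-sym {center} {blade _ _} _ = tt

  ⌢-irrefl : ∀ x → ¬ x ⌢ x
  ⌢-irrefl (blade _ _) (_ , p≢p) = p≢p refl

  enumeration : Fin (m * k + 1) ↔ WindmillVertex
  enumeration =
    ↔-trans +↔⊎ (↔-trans (*↔× ⊎-↔ 1↔⊤) (mk↔ₛ′ decode encode decode-encode encode-decode))
    where
    decode : Fin m × Fin k ⊎ ⊤ → WindmillVertex
    decode (inj₁ (β , p)) = blade β p
    decode (inj₂ _) = center
    encode : WindmillVertex → Fin m × Fin k ⊎ ⊤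
    encode (blade β p) = inj₁ (β , p)
    encode center = inj₂ tt
    decode-encode : ∀ x → decode (encode x) ≡ x
    decode-encode (blade _ _) = refl
    decode-encode center = refl
    encode-decode : ∀ x → encode (decode x) ≡ x
    encode-decode (inj₁ _) = refl
    encode-decode (inj₂ _) = refl

  center-dominating : ∀ x → x ≢ center → center ⌢ x
  center-dominating (blade _ _) _ = tt
  center-dominating center x≢center = x≢center refl

  sameBlade⇒⌢ : ∀ {β β' : Fin m} {p p' : Fin k} → β ≡ β' → blade β p ≢ blade β' p' →
    blade β p ⌢ blade β' p'
  sameBlade⇒⌢ β≡β' distinct = β≡β' , λ p≡p' → distinct (cong₂ blade β≡β' p≡p')

  bladeCover : NeighborhoodCliqueCover _⌢_ m
  bladeCover (blade β p) = (λ _ _ → β) , covered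
    where
    covered : ∀ {y y'} → blade β p ⌢ y → blade β p ⌢ y' → β ≡ β → y ≢ y' → y ⌢ y'
    covered {blade _ _} {blade _ _} (β≡γ , _) (β≡γ' , _) _ =
      sameBlade⇒⌢ (trans (sym β≡γ) β≡γ')
    covered {blade _ _} {center} _ _ _ _ = tt
    covered {center} {blade _ _} _ _ _ _ = tt
    covered {center} {center} _ _ _ distinct = distinct refl
  bladeCover center = bladeOf , covered
    where
    bladeOf : ∀ y → center ⌢ y → Fin m
    bladeOf (blade β _) _ = β
    covered : ∀ {y y'} r r' → bladeOf y r ≡ bladeOf y' r' → y ≢ y' → y ⌢ y'
    covered {blade _ _} {blade _ _} _ _ = sameBlade⇒⌢

  bladeClique : Fin m → Σ (Fin (suc k) → WindmillVertex) (Clique _⌢_)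
  bladeClique β = member , isClique
    where
    member : Fin (suc k) → WindmillVertex
    member zero = center
    member (suc p) = blade β p
    isClique : Clique _⌢_ member
    isClique zero zero distinct = distinct refl
    isClique zero (suc _) _ = tt
    isClique (suc _) zero _ = tt
    isClique (suc p) (suc p') distinct = refl , distinct ∘ cong suc

  positionColor : WindmillVertex → Fin (suc k)
  positionColor (blade _ p) = suc p
  positionColor center = zero

  positionColor-proper : ProperColoring _⌢_ positionColor
  positionColor-proper (blade _ _) (blade _ _) (_ , p≢p') = p≢p' ∘ suc-injective
  positionColor-proper (blade _ _) center _ ()
  positionColor-proper center (blade _ _) _ ()

  open DisjointCopies enumeration _⌢?_ ⌢-sym ⌢-irrefl public

proposition1 : (t k : ℕ) → 3 ≤ t → 1 ≤ k →
    Σ Graph λ G → K1t-free t G × ChromaticNumber G k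
    × BChromaticNumber G ((t ∸ 1) * (k ∸ 1) + 1)
proposition1 (suc t-1) (suc k-1) (s≤s (s≤s (s≤s z≤n))) (s≤s z≤n) =
  graph ,
  neighborhoodCliqueCover⇒K1t-free graph (copies-neighborhoodCliqueCover bladeCover) ≤-refl ,
  chromaticNumber graph (copies-colorable positionColor positionColor-proper)
    (copies-clique (Inverse.from enumeration center) (bladeClique zero)) ,
  bChromaticNumber graph (copies-hasBColoring center center-dominating) copies-maxDegree<
  where open Windmill t-1 k-1
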